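{- Let $w,u$ be words over $\{0,1\}$ of the same length $\ell\ge2$ and $h\in\{0,1\}^*$. Suppose $u$ has prefix $0^{k-1}$ for some $k\le\ell$, and $|h|<k$. Then $S_h(w)(u)$ has prefix $0^{k-|h|-1}$. In particular, if $|h|<\ell$, then $S_h(w)(0^{\ell-1}1)$ has prefix $0^{\ell-|h|-1}$.
   Context: For words $w=w_1\cdots w_\ell$, $u=u_1\cdots u_\ell$ over $\{0,1\}$ and $a\in\{0,1\}$, $S_a(w)(u)\in\{0,1\}^\ell$ is the word with $\ell$-th letter $u_\ell$ and $i$-th letter $u_i\oplus(u_{i+1}\wedge[w_{i+1}=a])$ for $1\le i\le\ell-1$ ($[\cdot]$ the indicator; $\oplus,\wedge$ XOR/AND). For $h=h_1\cdots h_r$, $S_h(w)=S_{h_1}(w)\circ\cdots\circ S_{h_r}(w)$ ($S_\varepsilon(w)$ the identity); $|h|$ is the length of $h$. -}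

module Defs where

open import Data.Bool using (Bool; true; false; _xor_; _∧_)
open import Data.Nat using (ℕ; zero; suc; _<_)
open import Data.Fin using (Fin; toℕ)
open import Data.Vec using (Vec; []; _∷_; lookup)
open import Data.List using (List; []; _∷_)
open import Relation.Binary.PropositionalEquality using (_≡_)

_==_ : Bool → Bool → Bool
true  == true  = true
false == false = true
true  == false = false
false == true  = false

S : ∀ {ℓ} → Bool → Vec Bool ℓ → Vec Bool ℓ → Vec Bool ℓ
S a [] [] = []
S a (x ∷ []) (y ∷ []) = y ∷ []
S a (x ∷ x′ ∷ ws) (y ∷ y′ ∷ us) =
  (y xor (y′ ∧ (x′ == a))) ∷ S a (x′ ∷ ws) (y′ ∷ us)

Sh : ∀ {ℓ} → List Bool → Vec Bool ℓ → Vec Bool ℓ → Vec Bool ℓ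
Sh [] w u = u
Sh (a ∷ h) w u = S a w (Sh h w u)

HasZeroPrefix : ∀ {ℓ} → ℕ → Vec Bool ℓ → Set
HasZeroPrefix m v = ∀ (i : Fin _) → toℕ i < m → lookup v i ≡ false

{-# OPTIONS --safe #-}
-- Letter i of S_a(w)(u) depends only on u_i and u_{i+1}, so one application of S_a
-- shortens a zero prefix by at most one letter; |h| applications shorten it by at
-- most |h|. The word 0^{ℓ-1}1 is the case k = ℓ.
module Submission where

open import Defs
open import Data.Bool using (Bool; true; false)
open import Data.Nat using (ℕ; suc; _+_; _≤_; _<_; _∸_; s≤s; z≤n)
open import Data.Nat.Properties using (+-suc; ≤-trans; ≤-reflexive; +-∸-assoc; m+[n∸m]≡n)
open import Data.List using (List; length; []; _∷_)
open import Data.Vec using (Vec; replicate; _∷ʳ_; []; _∷_)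
open import Data.Fin using () renaming (zero to fzero; suc to fsuc)
open import Data.Product using (_×_; _,_)
open import Relation.Binary.PropositionalEquality using (_≡_; refl; sym; cong; subst; module ≡-Reasoning)

HasZeroPrefix-antitone : ∀ {ℓ m n} {u : Vec Bool ℓ} → m ≤ n → HasZeroPrefix n u → HasZeroPrefix m u
HasZeroPrefix-antitone m≤n zeros i i<m = zeros i (≤-trans i<m m≤n)

HasZeroPrefix-replicate-∷ʳ : ∀ m → HasZeroPrefix m (replicate m false ∷ʳ true)
HasZeroPrefix-replicate-∷ʳ (suc m) fzero    _         = refl
HasZeroPrefix-replicate-∷ʳ (suc m) (fsuc i) (s≤s i<m) = HasZeroPrefix-replicate-∷ʳ m i i<m

S-HasZeroPrefix : ∀ {ℓ} a (w u : Vec Bool ℓ) n → HasZeroPrefix (suc n) u → HasZeroPrefix n (S a w u)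
S-HasZeroPrefix a (_ ∷ []) (_ ∷ []) n zeros fzero _ = zeros fzero (s≤s z≤n)
S-HasZeroPrefix a (_ ∷ _ ∷ _) (_ ∷ _ ∷ _) (suc n) zeros fzero _
  rewrite zeros fzero (s≤s z≤n) | zeros (fsuc fzero) (s≤s (s≤s z≤n)) = refl
S-HasZeroPrefix a (_ ∷ x′ ∷ w) (_ ∷ y′ ∷ u) (suc n) zeros (fsuc i) (s≤s i<n) =
  S-HasZeroPrefix a (x′ ∷ w) (y′ ∷ u) n (λ j j<n → zeros (fsuc j) (s≤s j<n)) i i<n

Sh-HasZeroPrefix : ∀ {ℓ} h (w u : Vec Bool ℓ) n →
                   HasZeroPrefix (length h + n) u → HasZeroPrefix n (Sh h w u)
Sh-HasZeroPrefix []      w u n zeros = zeros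
Sh-HasZeroPrefix (a ∷ h) w u n zeros =
  S-HasZeroPrefix a w (Sh h w u) n
    (Sh-HasZeroPrefix h w u (suc n) (subst (λ m → HasZeroPrefix m u) (sym (+-suc (length h) n)) zeros))

m+[n∸m∸1]≡n∸1 : ∀ {m n} → m < n → m + (n ∸ m ∸ 1) ≡ n ∸ 1
m+[n∸m∸1]≡n∸1 {m} {suc n} (s≤s m≤n) = begin
  m + (suc n ∸ m ∸ 1) ≡⟨ cong (λ k → m + (k ∸ 1)) (+-∸-assoc 1 m≤n) ⟩
  m + (n ∸ m)         ≡⟨ m+[n∸m]≡n m≤n ⟩
  n                   ∎
  where open ≡-Reasoning

Sh-HasZeroPrefix-∸ : ∀ {ℓ} h (w u : Vec Bool ℓ) k → HasZeroPrefix (k ∸ 1) u → length h < k →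
                     HasZeroPrefix (k ∸ length h ∸ 1) (Sh h w u)
Sh-HasZeroPrefix-∸ h w u k zeros |h|<k =
  Sh-HasZeroPrefix h w u _ (HasZeroPrefix-antitone {u = u} (≤-reflexive (m+[n∸m∸1]≡n∸1 |h|<k)) zeros)

lemma4p8 : (∀ (ℓ : ℕ) → 2 ≤ ℓ → (w u : Vec Bool ℓ) (h : List Bool) (k : ℕ) →
    k ≤ ℓ → HasZeroPrefix (k ∸ 1) u → length h < k →
    HasZeroPrefix (k ∸ length h ∸ 1) (Sh h w u))
    ×
    (∀ (m : ℕ) → 1 ≤ m → (w : Vec Bool (suc m)) (h : List Bool) →
    length h < suc m →
    HasZeroPrefix (suc m ∸ length h ∸ 1) (Sh h w (replicate m false ∷ʳ true)))
lemma4p8 = (λ ℓ _ w u h k _ → Sh-HasZeroPrefix-∸ h w u k)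
         , (λ m _ w h → Sh-HasZeroPrefix-∸ h w _ (suc m) (HasZeroPrefix-replicate-∷ʳ m))
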